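{- Let $([n],\triangleright)$ be a rack and let $(S,\triangleright)$ be a subrack, and let $C$ be the vertex set of a component of $G_S$ (hence also of $G_S^0$). Then $d_S^+(u) = d_S^+(v)$ for all $u,v\in C$.
   Context: Maps are written on the right. A rack on $[n]$ is given by a binary operation $\triangleright$; equivalently by maps $(f_y)_{y\in[n]}$ with $(x)f_y=x\triangleright y$, each a permutation of $[n]$, satisfying $f_{(y)f_z}=f_z^{ -1}f_yf_z$ for all $y,z$. A subset $S\subseteq[n]$ forms a subrack $(S,\triangleright)$ iff $(z)f_y\in S$ for all $y,z\in S$. $G_S$ is the directed loopless multigraph on $[n]$ with an edge of colour $y$ from $x$ to $z$ iff $y\in S$, $x\neq z$, $(x)f_y=z$; $G_S^0$ is the simple directed graph with an edge $\overrightarrow{xz}$ iff $G_S$ has at least one edge from $x$ to $z$. Components are those of the underlying undirected graph. $\Gamma_S^+(v)=\{(v)f_j: j\in S,\ (v)f_j\neq v\}$ and $d_S^+(v)=|\Gamma_S^+(v)|$ (the out-degree of $v$ in $G_S^0$). -}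

module Defs where

open import Data.Nat using (ℕ)
open import Data.Fin using (Fin; _≟_)
open import Data.Fin.Properties using (any?)
open import Data.Fin.Subset using (Subset; _∈_; ∣_∣)
open import Data.Fin.Subset.Properties using (_∈?_)
open import Data.Vec using (tabulate)
open import Data.Bool using (_∧_; not)
open import Data.Product using (Σ; ∃; _×_; _,_)
open import Relation.Nullary using (¬_; does)
open import Relation.Nullary.Decidable using (_×-dec_)
open import Relation.Binary.PropositionalEquality using (_≡_; _≢_)
open import Relation.Binary.Construct.Closure.Equivalence using (EqClosure)

-- A rack on [n] = Fin n, maps written on the right: (x) f_y = x ▷ y.
-- Rack axiom: f_{(y)f_z} = f_z^{-1} f_y f_z, i.e. (x) f_{y ▷ z} = (((x) f_z^{-1}) f_y) f_z.
record Rack (n : ℕ) : Set where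
  field
    _▷_ : Fin n → Fin n → Fin n
    _◁_ : Fin n → Fin n → Fin n
    ◁-▷ : ∀ x y → (x ◁ y) ▷ y ≡ x
    ▷-◁ : ∀ x y → (x ▷ y) ◁ y ≡ x
    conj : ∀ x y z → x ▷ (y ▷ z) ≡ ((x ◁ z) ▷ y) ▷ z

module _ {n : ℕ} (R : Rack n) where
  open Rack R

  IsSubrack : Subset n → Set
  IsSubrack S = ∀ y z → y ∈ S → z ∈ S → (z ▷ y) ∈ S

  -- Edge of G_S^0 (equivalently, at least one edge of G_S) from x to z
  Edge : Subset n → Fin n → Fin n → Set
  Edge S x z = ∃ λ y → y ∈ S × x ≢ z × x ▷ y ≡ z

  SameComponent : Subset n → Fin n → Fin n → Set
  SameComponent S = EqClosure (Edge S)

  Γ⁺ : Subset n → Fin n → Subset n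
  Γ⁺ S v = tabulate λ w →
    does (any? (λ j → (j ∈? S) ×-dec (v ▷ j ≟ w))) ∧ not (does (w ≟ v))

  d⁺ : Subset n → Fin n → ℕ
  d⁺ S v = ∣ Γ⁺ S v ∣

-- For y ∈ S the rack axiom makes f_y an automorphism of the edge structure of G_S:
-- x ▷ j ↦ (x ▷ y) ▷ (j ▷ y), where j ↦ j ▷ y permutes the finite subrack S. Hence
-- f_y maps Γ_S^+(x) bijectively onto Γ_S^+(x ▷ y), so d_S^+ is constant along
-- every edge and therefore on components.
module Submission where

open import Defs
open import Algebra.Definitions using (_DistributesOverʳ_)
import Data.Nat.Properties as ℕ
open import Algebra.Properties.CommutativeMonoid.Sum ℕ.+-0-commutativeMonoid using (sum; sum-cong-≗; sum-permute)
open import Data.Bool using (true; if_then_else_; _∧_; not)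
open import Data.Fin using (Fin; _≟_)
open import Data.Fin.Permutation using (Permutation; Permutation′; permutation; _⟨$⟩ʳ_)
open import Data.Fin.Properties using (any?)
open import Data.Fin.Subset using (Side; Subset; _∈_; _⊆_; ∣_∣; inside; outside)
open import Data.Fin.Subset.Properties using (_∈?_; ⊆-antisym; p⊂q⇒∣p∣<∣q∣)
open import Data.Nat using (ℕ)
open import Data.Product using (∃; _×_; _,_)
open import Data.Vec using (_∷_; []; tabulate; lookup)
open import Data.Vec.Properties using ([]=↔lookup; lookup∘tabulate)
open import Function using (_∘_; _⇔_; mk⇔; Equivalence)
open import Function.Construct.Composition using (_⇔-∘_)
open import Function.Construct.Symmetry using (⇔-sym)
open import Function.Properties.Inverse using (↔⇒⇔)
open import Relation.Binary.Construct.Closure.Equivalence using (gfold)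
open import Relation.Binary.PropositionalEquality
open import Relation.Nullary using (¬_; Dec; yes; no; does; contradiction)
open import Relation.Nullary.Decidable using (_×-dec_)

private
  variable
    m n : ℕ

preimage : (Fin m → Fin n) → Subset n → Subset m
preimage f p = tabulate (lookup p ∘ f)

∈⇔lookup≡inside : ∀ {p : Subset n} {x} → x ∈ p ⇔ lookup p x ≡ inside
∈⇔lookup≡inside = ↔⇒⇔ []=↔lookup

∈-tabulate⇔ : ∀ {f : Fin n → Side} {x} → x ∈ tabulate f ⇔ f x ≡ inside
∈-tabulate⇔ {f = f} {x} = mk⇔
  (λ x∈ → trans (sym (lookup∘tabulate f x)) (Equivalence.to ∈⇔lookup≡inside x∈))
  (λ fx≡inside → Equivalence.from ∈⇔lookup≡inside (trans (lookup∘tabulate f x) fx≡inside))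

∈-preimage⇔ : ∀ {f : Fin m → Fin n} {p x} → x ∈ preimage f p ⇔ f x ∈ p
∈-preimage⇔ = ⇔-sym ∈⇔lookup≡inside ⇔-∘ ∈-tabulate⇔

indicator : Subset n → Fin n → ℕ
indicator p i = if lookup p i then 1 else 0

∣p∣≡∑indicator : ∀ (p : Subset n) → ∣ p ∣ ≡ sum (indicator p)
∣p∣≡∑indicator []            = refl
∣p∣≡∑indicator (inside  ∷ p) = cong ℕ.suc (∣p∣≡∑indicator p)
∣p∣≡∑indicator (outside ∷ p) = ∣p∣≡∑indicator p

∣preimage∣≡∣p∣ : ∀ (π : Permutation m n) p → ∣ preimage (π ⟨$⟩ʳ_) p ∣ ≡ ∣ p ∣
∣preimage∣≡∣p∣ π p = begin
  ∣ preimage (π ⟨$⟩ʳ_) p ∣               ≡⟨ ∣p∣≡∑indicator (preimage (π ⟨$⟩ʳ_) p) ⟩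
  sum (indicator (preimage (π ⟨$⟩ʳ_) p)) ≡⟨ sum-cong-≗ (λ i → cong (if_then 1 else 0) (lookup∘tabulate (lookup p ∘ (π ⟨$⟩ʳ_)) i)) ⟩
  sum (indicator p ∘ (π ⟨$⟩ʳ_))          ≡⟨ sum-permute (indicator p) π ⟨
  sum (indicator p)                      ≡⟨ ∣p∣≡∑indicator p ⟨
  ∣ p ∣                                  ∎
  where open ≡-Reasoning

p⊆q∧∣p∣≡∣q∣⇒q⊆p : ∀ {p q : Subset n} → p ⊆ q → ∣ p ∣ ≡ ∣ q ∣ → q ⊆ p
p⊆q∧∣p∣≡∣q∣⇒q⊆p {p = p} p⊆q ∣p∣≡∣q∣ {x} x∈q with x ∈? p
... | yes x∈p = x∈p
... | no  x∉p = contradiction ∣p∣≡∣q∣ (ℕ.<⇒≢ (p⊂q⇒∣p∣<∣q∣ (p⊆q , x , x∈q , x∉p)))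

does∧not-does≡true⇔ : ∀ {a b} {A : Set a} {B : Set b} (a? : Dec A) (b? : Dec B) →
                      does a? ∧ not (does b?) ≡ true ⇔ (A × ¬ B)
does∧not-does≡true⇔ (yes a) (no ¬b) = mk⇔ (λ _ → a , ¬b) (λ _ → refl)
does∧not-does≡true⇔ (yes a) (yes b) = mk⇔ (λ ()) (λ (_ , ¬b) → contradiction b ¬b)
does∧not-does≡true⇔ (no ¬a) _       = mk⇔ (λ ()) (λ (a , _) → contradiction a ¬a)

module _ (R : Rack n) where
  open Rack R

  ◁-permutation : Fin n → Permutation′ n
  ◁-permutation y = permutation (_◁ y) (_▷ y) (λ x → ▷-◁ x y) (λ x → ◁-▷ x y)

  ▷-distribʳ : _DistributesOverʳ_ _≡_ _▷_ _▷_
  ▷-distribʳ y x j = begin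
    (x ▷ j) ▷ y                ≡⟨ cong (λ t → (t ▷ j) ▷ y) (▷-◁ x y) ⟨
    (((x ▷ y) ◁ y) ▷ j) ▷ y    ≡⟨ conj (x ▷ y) j y ⟨
    (x ▷ y) ▷ (j ▷ y)          ∎
    where open ≡-Reasoning

  ▷-moveʳ : ∀ {a b y} → a ▷ y ≡ b → a ≡ b ◁ y
  ▷-moveʳ {a} {b} {y} a▷y≡b = trans (sym (▷-◁ a y)) (cong (_◁ y) a▷y≡b)

  ◁-moveʳ : ∀ {a b y} → a ◁ y ≡ b → a ≡ b ▷ y
  ◁-moveʳ {a} {b} {y} a◁y≡b = trans (sym (◁-▷ a y)) (cong (_▷ y) a◁y≡b)

  -- A subrack is only assumed closed under ▷; finiteness makes f_y⁻¹ map S into S,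
  -- since S ⊆ f_y(S) is forced by ∣f_y(S)∣ = ∣S∣.
  ◁-closed : ∀ {S} → IsSubrack R S → ∀ {y k} → y ∈ S → k ∈ S → k ◁ y ∈ S
  ◁-closed {S} closed {y} y∈S k∈S =
    Equivalence.to ∈-preimage⇔ (p⊆q∧∣p∣≡∣q∣⇒q⊆p preimage⊆S (∣preimage∣≡∣p∣ (◁-permutation y) S) k∈S)
    where
    preimage⊆S : preimage (_◁ y) S ⊆ S
    preimage⊆S {w} w∈ = subst (_∈ S) (◁-▷ w y) (closed y (w ◁ y) y∈S (Equivalence.to ∈-preimage⇔ w∈))

  ∈Γ⁺⇔ : ∀ {S v w} → w ∈ Γ⁺ R S v ⇔ ((∃ λ j → j ∈ S × v ▷ j ≡ w) × w ≢ v)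
  ∈Γ⁺⇔ {S} {v} {w} =
    does∧not-does≡true⇔ (any? λ j → (j ∈? S) ×-dec (v ▷ j ≟ w)) (w ≟ v) ⇔-∘ ∈-tabulate⇔

  module _ {S : Subset n} (closed : IsSubrack R S) {y : Fin n} (y∈S : y ∈ S) where

    Γ⁺-▷ : ∀ x → Γ⁺ R S (x ▷ y) ≡ preimage (_◁ y) (Γ⁺ R S x)
    Γ⁺-▷ x = ⊆-antisym (Equivalence.from ∈-preimage⇔ ∘ to) (from ∘ Equivalence.to ∈-preimage⇔)
      where
      open ≡-Reasoning

      to : ∀ {w} → w ∈ Γ⁺ R S (x ▷ y) → w ◁ y ∈ Γ⁺ R S x
      to {w} w∈Γ⁺ with Equivalence.to ∈Γ⁺⇔ w∈Γ⁺
      ... | (k , k∈S , x▷y▷k≡w) , w≢x▷y =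
        Equivalence.from ∈Γ⁺⇔ ((k ◁ y , ◁-closed closed y∈S k∈S , ▷-moveʳ x▷[k◁y]▷y≡w) , w≢x▷y ∘ ◁-moveʳ)
        where
        x▷[k◁y]▷y≡w : (x ▷ (k ◁ y)) ▷ y ≡ w
        x▷[k◁y]▷y≡w = begin
          (x ▷ (k ◁ y)) ▷ y          ≡⟨ ▷-distribʳ y x (k ◁ y) ⟩
          (x ▷ y) ▷ ((k ◁ y) ▷ y)    ≡⟨ cong ((x ▷ y) ▷_) (◁-▷ k y) ⟩
          (x ▷ y) ▷ k                ≡⟨ x▷y▷k≡w ⟩
          w                          ∎

      from : ∀ {w} → w ◁ y ∈ Γ⁺ R S x → w ∈ Γ⁺ R S (x ▷ y)
      from {w} w◁y∈Γ⁺ with Equivalence.to ∈Γ⁺⇔ w◁y∈Γ⁺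
      ... | (j , j∈S , x▷j≡w◁y) , w◁y≢x =
        Equivalence.from ∈Γ⁺⇔ ((j ▷ y , closed y j y∈S j∈S , x▷y▷[j▷y]≡w) , w◁y≢x ∘ sym ∘ ▷-moveʳ ∘ sym)
        where
        x▷y▷[j▷y]≡w : (x ▷ y) ▷ (j ▷ y) ≡ w
        x▷y▷[j▷y]≡w = begin
          (x ▷ y) ▷ (j ▷ y)    ≡⟨ ▷-distribʳ y x j ⟨
          (x ▷ j) ▷ y          ≡⟨ cong (_▷ y) x▷j≡w◁y ⟩
          (w ◁ y) ▷ y          ≡⟨ ◁-▷ w y ⟩
          w                    ∎

    d⁺-▷ : ∀ x → d⁺ R S (x ▷ y) ≡ d⁺ R S x
    d⁺-▷ x = trans (cong ∣_∣ (Γ⁺-▷ x)) (∣preimage∣≡∣p∣ (◁-permutation y) (Γ⁺ R S x))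

  Edge⇒d⁺≡ : ∀ {S} → IsSubrack R S → ∀ {x z} → Edge R S x z → d⁺ R S x ≡ d⁺ R S z
  Edge⇒d⁺≡ closed {x} (y , y∈S , _ , refl) = sym (d⁺-▷ closed y∈S x)

lemma4p2 : (n : ℕ) (R : Rack n) (S : Subset n) → IsSubrack R S →
           (u v : Fin n) → SameComponent R S u v → d⁺ R S u ≡ d⁺ R S v
lemma4p2 n R S closed u v = gfold isEquivalence (d⁺ R S) (Edge⇒d⁺≡ R closed)
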